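{- Let $(G_1,G_2,S)$ be a constrained alignment instance with $m_1=2$ and $m_2=1$, and let $v$ be a $c_4$ written $abcd$. Then: (1) Any $c_4$ that conflicts with $v$ with a Type1a (resp. Type1b) configuration conflicts with at most one $c_4$ that is in a Type1a (resp. Type1b) configuration with $v$. (2) Any $c_4$ that conflicts with $v$ with a Type1a (resp. Type1b) configuration conflicts with at most one $c_4$ that is in a Type1b (resp. Type1a) configuration with $v$. (3) Any $c_4$ that conflicts with $v$ with a Type1 configuration does not conflict with any $c_4$ that is in a Type2 configuration with $v$. (4) Any $c_4$ that conflicts with $v$ with a Type3a (resp. Type3b) configuration conflicts with every $c_4$ that is in a Type1b (resp. Type1a) configuration with $v$. (5) Any $c_4$ that conflicts with $v$ with a Type3a (resp. Type3b) configuration does not conflict with any $c_4$ that is in a Type1a (resp. Type1b) configuration with $v$. (6) There do not exist three pairwise conflicting $c_4$s each of which is in a Type1 configuration with $v$. (7) For $k\geq 4$, there is no induced path $P_k$ in the conflict graph $\mathcal{C}$ all of whose vertices are $c_4$s in a Type1 configuration with $v$.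
   Context: Let $G_1=(V_1,E_1)$ and $G_2=(V_2,E_2)$ be finite simple undirected graphs with $V_1\cap V_2=\emptyset$, and let $S$ be a bipartite graph with parts $V_1,V_2$ in which every vertex of $V_1$ has degree at most $m_1$ and every vertex of $V_2$ has degree at most $m_2$; edges of $S$ are similarity edges. A $c_4$ is a 4-cycle $a-b-c-d-a$ in $G_1\cup G_2\cup S$ with $a,b\in V_1$, $c,d\in V_2$, $ab\in E_1$, $cd\in E_2$, $ad,bc\in E(S)$, written $abcd$ and regarded as a subgraph. Two distinct $c_4$s conflict if their similarity edges cannot all belong to a common matching of $S$. The conflict graph $\mathcal{C}$ has one vertex per $c_4$ and an edge between each pair of conflicting $c_4$s. With $m_2=1$, for $v=abcd$ and a $c_4$ $w$ conflicting with $v$: $w$ is in a Type1 configuration with $v$ if they share exactly one vertex of $V_1$; Type2 if they share both vertices of $V_1$ and no vertex of $V_2$; Type3 if they share both vertices of $V_1$ and exactly one vertex of $V_2$. A Type1 configuration is Type1a if the shared vertex is $a$ (so $w$ contains a similarity edge $af$ with $f\neq d$) and Type1b if it is $b$ (so $w$ contains $bf$ with $f\neq c$). A Type3 configuration is Type3a if $w$ contains a similarity edge $af$ with $f\neq d$ (i.e. $w$ shares $c$ but not $d$) and Type3b if $w$ contains $bf$ with $f\neq c$ (i.e. $w$ shares $d$ but not $c$). -}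

module Defs where

open import Data.Nat using (ℕ; suc; _≤_)
open import Data.Fin using (Fin; toℕ)
open import Data.Bool using (Bool; true; false)
open import Data.Vec using (tabulate)
open import Data.Fin.Subset using (∣_∣)
open import Data.Product using (Σ; ∃; _×_; _,_; proj₁; proj₂)
open import Data.Sum using (_⊎_)
open import Relation.Binary.PropositionalEquality using (_≡_; _≢_)
open import Relation.Nullary using (¬_)
open import Function.Bundles using (_⇔_)

record Graph (n : ℕ) : Set where
  field
    adj    : Fin n → Fin n → Bool
    sym    : ∀ x y → adj x y ≡ adj y x
    irrefl : ∀ x → adj x x ≡ false

-- V1 = Fin n1 and V2 = Fin n2 are distinct types, hence disjoint;
-- S is a bipartite graph between V1 and V2, given by S x y for x ∈ V1, y ∈ V2.
record Instance (m1 m2 : ℕ) : Set where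
  field
    n1 n2 : ℕ
    G1    : Graph n1
    G2    : Graph n2
    S     : Fin n1 → Fin n2 → Bool
    deg1  : ∀ (x : Fin n1) → ∣ tabulate (λ y → S x y) ∣ ≤ m1
    deg2  : ∀ (y : Fin n2) → ∣ tabulate (λ x → S x y) ∣ ≤ m2

module _ {m1 m2 : ℕ} (I : Instance m1 m2) where
  open Instance I

  SimEdge : Set
  SimEdge = Fin n1 × Fin n2

  record C4 : Set where
    constructor c4
    field
      a b : Fin n1
      c d : Fin n2
      ab∈E1 : Graph.adj G1 a b ≡ true
      cd∈E2 : Graph.adj G2 c d ≡ true
      ad∈S  : S a d ≡ true
      bc∈S  : S b c ≡ true

  open C4

  -- equality of c4s as subgraphs: abcd and badc denote the same subgraph
  Same : C4 → C4 → Set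
  Same v w = (a v ≡ a w × b v ≡ b w × c v ≡ c w × d v ≡ d w)
           ⊎ (a v ≡ b w × b v ≡ a w × c v ≡ d w × d v ≡ c w)

  InSim : C4 → SimEdge → Set
  InSim w e = e ≡ (a w , d w) ⊎ e ≡ (b w , c w)

  InV1 : C4 → Fin n1 → Set
  InV1 w x = x ≡ a w ⊎ x ≡ b w

  InV2 : C4 → Fin n2 → Set
  InV2 w y = y ≡ c w ⊎ y ≡ d w

  NotMatching : (SimEdge → Set) → Set
  NotMatching E = Σ SimEdge λ e → Σ SimEdge λ e' →
    E e × E e' × e ≢ e' × (proj₁ e ≡ proj₁ e' ⊎ proj₂ e ≡ proj₂ e')

  -- two distinct c4s conflict if their similarity edges together
  -- do not form a matching (so cannot lie in a common matching of S)
  Conflict : C4 → C4 → Set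
  Conflict v w = ¬ Same v w × NotMatching (λ e → InSim v e ⊎ InSim w e)

  Type1a : C4 → C4 → Set
  Type1a v w = Conflict v w × InV1 w (a v) × ¬ InV1 w (b v)

  Type1b : C4 → C4 → Set
  Type1b v w = Conflict v w × InV1 w (b v) × ¬ InV1 w (a v)

  Type1 : C4 → C4 → Set
  Type1 v w = Type1a v w ⊎ Type1b v w

  Type2 : C4 → C4 → Set
  Type2 v w = Conflict v w × InV1 w (a v) × InV1 w (b v)
            × ¬ InV2 w (c v) × ¬ InV2 w (d v)

  Type3 : C4 → C4 → Set
  Type3 v w = Conflict v w × InV1 w (a v) × InV1 w (b v)
            × ((InV2 w (c v) × ¬ InV2 w (d v)) ⊎ (¬ InV2 w (c v) × InV2 w (d v)))

  Type3a : C4 → C4 → Set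
  Type3a v w = Type3 v w × Σ (Fin n2) λ f → f ≢ d v × InSim w (a v , f)

  Type3b : C4 → C4 → Set
  Type3b v w = Type3 v w × Σ (Fin n2) λ f → f ≢ c v × InSim w (b v , f)

  AtMostOne : (C4 → Set) → Set
  AtMostOne P = ∀ x y → P x → P y → Same x y

  InducedPath : (k : ℕ) → (Fin k → C4) → Set
  InducedPath k f =
      (∀ i j → i ≢ j → ¬ Same (f i) (f j))
    × (∀ i j → Conflict (f i) (f j) ⇔ (toℕ j ≡ suc (toℕ i) ⊎ toℕ i ≡ suc (toℕ j)))

module Submission where

-- With m2 = 1 two c4s conflict exactly when they leave some common vertex g of V1 along
-- different similarity edges (a clash at g), and with m1 = 2 no three c4s can pairwise
-- clash at g.  A Type1 c4 meets V1(v) in a single vertex z, which it must leave along the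
-- edge of z that v does not use; hence two Type1 c4s never clash inside V1(v), and since
-- each has exactly one V1 vertex outside V1(v), every conflict among Type1 c4s takes place
-- at these outer vertices, which coincide along any chain of conflicts.  This gives
-- (1), (2), (6) and (7).  For (3)-(5) the clash must happen inside V1(v), where it is
-- decided by comparing each c4 with the edge of v at the clash vertex.

open import Defs
open import Data.Nat using (ℕ; _≥_; suc; _+_; _≤_; s≤s; s≤s⁻¹)
open import Data.Nat.Properties using (<-≤-trans)
open import Data.Fin using (Fin; zero; suc)
open import Data.Fin.Properties using (_≟_)
open import Data.Fin.Subset using (Subset; ∣_∣; _∈_; _∉_; _-_)
open import Data.Fin.Subset.Properties using (x∈p⇒∣p-x∣<∣p∣; x∈p∧x≢y⇒x∈p-y)
open import Data.Bool using (Bool; true)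
open import Data.Empty using (⊥)
open import Data.Vec using (tabulate)
open import Data.Vec.Properties using (lookup⇒[]=; lookup∘tabulate)
open import Data.Product using (∃; _×_; _,_; proj₁; proj₂)
open import Data.Sum using (_⊎_; inj₁; inj₂; swap)
open import Function using (_∘_; case_of_)
open import Function.Bundles using (Equivalence)
open import Relation.Nullary using (¬_; yes; no; contradiction)
open import Relation.Nullary.Decidable using (decidable-stable)
open import Relation.Binary.PropositionalEquality
  using (_≡_; _≢_; refl; sym; trans; cong; subst)

private
  variable
    n k : ℕ
    p : Subset n
    i j l : Fin n

i∈tabulate : (f : Fin n → Bool) → f i ≡ true → i ∈ tabulate f
i∈tabulate {i = i} f fi = lookup⇒[]= i (tabulate f) (trans (lookup∘tabulate f i) fi)

∣p∣≤0⇒i∉p : ∣ p ∣ ≤ 0 → i ∉ p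
∣p∣≤0⇒i∉p ∣p∣≤0 i∈p with () ← <-≤-trans (x∈p⇒∣p-x∣<∣p∣ i∈p) ∣p∣≤0

∣p∣≤1+k⇒∣p-i∣≤k : ∣ p ∣ ≤ suc k → i ∈ p → ∣ p - i ∣ ≤ k
∣p∣≤1+k⇒∣p-i∣≤k ∣p∣≤1+k i∈p = s≤s⁻¹ (<-≤-trans (x∈p⇒∣p-x∣<∣p∣ i∈p) ∣p∣≤1+k)

∣p∣≤1⇒i≡j : ∣ p ∣ ≤ 1 → i ∈ p → j ∈ p → i ≡ j
∣p∣≤1⇒i≡j {i = i} {j = j} ∣p∣≤1 i∈p j∈p with i ≟ j
... | yes i≡j = i≡j
... | no i≢j  = contradiction (x∈p∧x≢y⇒x∈p-y j∈p (i≢j ∘ sym))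
                              (∣p∣≤0⇒i∉p (∣p∣≤1+k⇒∣p-i∣≤k ∣p∣≤1 i∈p))

∣p∣≤2⇒j≡l : ∣ p ∣ ≤ 2 → i ∈ p → j ∈ p → l ∈ p → i ≢ j → i ≢ l → j ≡ l
∣p∣≤2⇒j≡l ∣p∣≤2 i∈p j∈p l∈p i≢j i≢l =
  ∣p∣≤1⇒i≡j (∣p∣≤1+k⇒∣p-i∣≤k ∣p∣≤2 i∈p)
            (x∈p∧x≢y⇒x∈p-y j∈p (i≢j ∘ sym)) (x∈p∧x≢y⇒x∈p-y l∈p (i≢l ∘ sym))


module C4Properties {m1 m2 : ℕ} (I : Instance m1 m2) where
  open Instance I
  open C4

  private
    variable
      w x : C4 I
      z : Fin n1
      t t' : Fin n2

  a≢b : (w : C4 I) → a w ≢ b w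
  a≢b w a≡b with () ← trans (sym (ab∈E1 w))
                             (subst (λ b → Graph.adj G1 (a w) b ≡ _) a≡b (Graph.irrefl G1 (a w)))

  InSim⇒S : (w : C4 I) → InSim I w (z , t) → S z t ≡ true
  InSim⇒S w (inj₁ refl) = ad∈S w
  InSim⇒S w (inj₂ refl) = bc∈S w

  InSim⇒InV1 : (w : C4 I) → InSim I w (z , t) → InV1 I w z
  InSim⇒InV1 w (inj₁ refl) = inj₁ refl
  InSim⇒InV1 w (inj₂ refl) = inj₂ refl

  InSim⇒InV2 : (w : C4 I) → InSim I w (z , t) → InV2 I w t
  InSim⇒InV2 w (inj₁ refl) = inj₂ refl
  InSim⇒InV2 w (inj₂ refl) = inj₁ refl

  InV1⇒InSim : (w : C4 I) → InV1 I w z → ∃ λ t → InSim I w (z , t)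
  InV1⇒InSim w (inj₁ refl) = d w , inj₁ refl
  InV1⇒InSim w (inj₂ refl) = c w , inj₂ refl

  InV2⇒InSim : (w : C4 I) → InV2 I w t → ∃ λ z → InSim I w (z , t)
  InV2⇒InSim w (inj₁ refl) = b w , inj₂ refl
  InV2⇒InSim w (inj₂ refl) = a w , inj₁ refl

  InSim-unique : (w : C4 I) → InSim I w (z , t) → InSim I w (z , t') → t ≡ t'
  InSim-unique w (inj₁ refl) (inj₁ refl) = refl
  InSim-unique w (inj₁ refl) (inj₂ refl) = contradiction refl (a≢b w)
  InSim-unique w (inj₂ refl) (inj₁ refl) = contradiction refl (a≢b w)
  InSim-unique w (inj₂ refl) (inj₂ refl) = refl

  InV1-covered : (w : C4 I) {p q r : Fin n1} → InV1 I w p → InV1 I w q → p ≢ q → InV1 I w r →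
                 r ≡ p ⊎ r ≡ q
  InV1-covered w (inj₁ refl) (inj₁ refl) p≢q _ = contradiction refl p≢q
  InV1-covered w (inj₂ refl) (inj₂ refl) p≢q _ = contradiction refl p≢q
  InV1-covered w (inj₁ refl) (inj₂ refl) _ r∈w = r∈w
  InV1-covered w (inj₂ refl) (inj₁ refl) _ r∈w = swap r∈w

  InV1-other-unique : (w : C4 I) {p q r : Fin n1} → InV1 I w p → InV1 I w q → InV1 I w r →
                      p ≢ q → p ≢ r → q ≡ r
  InV1-other-unique w p∈w q∈w r∈w p≢q p≢r with InV1-covered w p∈w q∈w p≢q r∈w
  ... | inj₁ r≡p = contradiction (sym r≡p) p≢r
  ... | inj₂ r≡q = sym r≡q

  Same⇒InV1 : (w x : C4 I) → Same I w x → InV1 I w z → InV1 I x z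
  Same⇒InV1 _ _ (inj₁ (refl , refl , _)) z∈w = z∈w
  Same⇒InV1 _ _ (inj₂ (refl , refl , _)) z∈w = swap z∈w

  shared-edges⇒Same : (w x : C4 I) {e e' : SimEdge I} →
                      InSim I w e → InSim I w e' → InSim I x e → InSim I x e' →
                      proj₁ e ≢ proj₁ e' → Same I w x
  shared-edges⇒Same (c4 _ _ _ _ _ _ _ _) (c4 _ _ _ _ _ _ _ _) = λ where
    (inj₁ refl) (inj₁ refl) _ _ e≢e' → contradiction refl e≢e'
    (inj₂ refl) (inj₂ refl) _ _ e≢e' → contradiction refl e≢e'
    _ _ (inj₁ refl) (inj₁ refl) e≢e' → contradiction refl e≢e'
    _ _ (inj₂ refl) (inj₂ refl) e≢e' → contradiction refl e≢e'
    (inj₁ refl) (inj₂ refl) (inj₁ refl) (inj₂ refl) _ → inj₁ (refl , refl , refl , refl)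
    (inj₁ refl) (inj₂ refl) (inj₂ refl) (inj₁ refl) _ → inj₂ (refl , refl , refl , refl)
    (inj₂ refl) (inj₁ refl) (inj₁ refl) (inj₂ refl) _ → inj₂ (refl , refl , refl , refl)
    (inj₂ refl) (inj₁ refl) (inj₂ refl) (inj₁ refl) _ → inj₁ (refl , refl , refl , refl)

  -- vacuous unless both c4s contain z; Clash records the memberships
  DiffersAt : C4 I → C4 I → Fin n1 → Set
  DiffersAt w x z = ∀ {t t'} → InSim I w (z , t) → InSim I x (z , t') → t ≢ t'

  record Clash (w x : C4 I) (z : Fin n1) : Set where
    constructor clash
    field
      ∈ˡ      : InV1 I w z
      ∈ʳ      : InV1 I x z
      differs : DiffersAt w x z

  Clash-sym : Clash w x z → Clash x w z
  Clash-sym (clash z∈w z∈x differs) = clash z∈x z∈w λ s s' → differs s' s ∘ sym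

  ≢⇒DiffersAt : (w x : C4 I) → InSim I w (z , t) → InSim I x (z , t') → t ≢ t' → DiffersAt w x z
  ≢⇒DiffersAt w x s s' t≢t' r r' r≡r' =
    t≢t' (trans (InSim-unique w s r) (trans r≡r' (InSim-unique x r' s')))

  Clash⇒Conflict : (w x : C4 I) → ¬ Same I w x → Clash w x z → Conflict I w x
  Clash⇒Conflict {z = z} w x w≉x (clash z∈w z∈x differs)
    with InV1⇒InSim w z∈w | InV1⇒InSim x z∈x
  ... | t , s | t' , s' =
    w≉x , (z , t) , (z , t') , inj₁ s , inj₂ s' , differs s s' ∘ cong proj₂ , inj₁ refl

  non-conflicting-agree : (w x : C4 I) → ¬ Same I w x → ¬ Conflict I w x →
                          InSim I w (z , t) → InSim I x (z , t') → t ≡ t'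
  non-conflicting-agree {t = t} {t'} w x w≉x ¬w#x s s' = decidable-stable (t ≟ t') λ t≢t' →
    ¬w#x (Clash⇒Conflict w x w≉x (clash (InSim⇒InV1 w s) (InSim⇒InV1 x s') (≢⇒DiffersAt w x s s' t≢t')))

module AtMostOneV2Neighbour {m1 : ℕ} (I : Instance m1 1) where
  open Instance I
  open C4Properties I

  V2-neighbour-unique : ∀ {x x' y} → S x y ≡ true → S x' y ≡ true → x ≡ x'
  V2-neighbour-unique {y = y} Sxy Sx'y =
    ∣p∣≤1⇒i≡j (deg2 y) (i∈tabulate (λ x → S x y) Sxy) (i∈tabulate (λ x → S x y) Sx'y)

  private
    variable
      z : Fin n1
      t : Fin n2

  InV2⇒InSim-shared : (v w : C4 I) → InSim I v (z , t) → InV2 I w t → InSim I w (z , t)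
  InV2⇒InSim-shared v w s t∈w with InV2⇒InSim w t∈w
  ... | _ , s' with V2-neighbour-unique (InSim⇒S w s') (InSim⇒S v s)
  ... | refl = s'

  -- Edges sharing their V2 end share their V1 end as well, so a conflict is a clash.
  Conflict⇒Clash : (w x : C4 I) → Conflict I w x → ∃ (Clash w x)
  Conflict⇒Clash w x (_ , (z , t) , (z' , t') , s , s' , e≢e' , inj₂ refl) =
    contradiction (cong (_, t) (V2-neighbour-unique (InSim⇒S-either s) (InSim⇒S-either s'))) e≢e'
    where
    InSim⇒S-either : ∀ {e} → InSim I w e ⊎ InSim I x e → S (proj₁ e) (proj₂ e) ≡ true
    InSim⇒S-either (inj₁ s) = InSim⇒S w s
    InSim⇒S-either (inj₂ s) = InSim⇒S x s
  Conflict⇒Clash w x (_ , (z , t) , (_ , t') , s , s' , e≢e' , inj₁ refl) = z , clash-at s s'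
    where
    t≢t' : t ≢ t'
    t≢t' = e≢e' ∘ cong (z ,_)
    clash-at : InSim I w (z , t) ⊎ InSim I x (z , t) → InSim I w (z , t') ⊎ InSim I x (z , t') →
               Clash w x z
    clash-at (inj₁ s) (inj₁ s') = contradiction (InSim-unique w s s') t≢t'
    clash-at (inj₂ s) (inj₂ s') = contradiction (InSim-unique x s s') t≢t'
    clash-at (inj₁ s) (inj₂ s') =
      clash (InSim⇒InV1 w s) (InSim⇒InV1 x s') (≢⇒DiffersAt w x s s' t≢t')
    clash-at (inj₂ s) (inj₁ s') =
      clash (InSim⇒InV1 w s') (InSim⇒InV1 x s) (≢⇒DiffersAt w x s' s (t≢t' ∘ sym))

module AtMostTwoV1Neighbours {m2 : ℕ} (I : Instance 2 m2) where
  open Instance I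
  open C4Properties I

  private
    variable
      u w x : C4 I
      z : Fin n1

  V1-other-neighbour-unique : ∀ {x t y y'} → S x t ≡ true → S x y ≡ true → S x y' ≡ true →
                              t ≢ y → t ≢ y' → y ≡ y'
  V1-other-neighbour-unique {x = x} Sxt Sxy Sxy' =
    ∣p∣≤2⇒j≡l (deg1 x) (i∈tabulate (S x) Sxt) (i∈tabulate (S x) Sxy) (i∈tabulate (S x) Sxy')

  Clash⇒common-edge : Clash u w z → Clash u x z → ∃ λ t → InSim I w (z , t) × InSim I x (z , t)
  Clash⇒common-edge {u = u} {w = w} {x = x} (clash z∈u z∈w u≠w) (clash _ z∈x u≠x)
    with InV1⇒InSim u z∈u | InV1⇒InSim w z∈w | InV1⇒InSim x z∈x
  ... | _ , su | t , sw | _ , sx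
    with V1-other-neighbour-unique (InSim⇒S u su) (InSim⇒S w sw) (InSim⇒S x sx) (u≠w su sw) (u≠x su sx)
  ... | refl = t , sw , sx

  no-clash-triangle : Clash u w z → Clash u x z → ¬ Clash w x z
  no-clash-triangle u≠w u≠x (clash _ _ w≠x) with Clash⇒common-edge u≠w u≠x
  ... | _ , sw , sx = w≠x sw sx refl

module Configurations (I : Instance 2 1) (v : C4 I) where
  open Instance I
  open C4
  open C4Properties I
  open AtMostOneV2Neighbour I
  open AtMostTwoV1Neighbours I

  private
    variable
      w x y : C4 I
      z z' g g' : Fin n1
      t t' f : Fin n2

  record Type1At (x : C4 I) (z : Fin n1) : Set where
    field
      conflict : Conflict I v x
      ∈v       : InV1 I v z
      ∈x       : InV1 I x z
      unique   : ∀ {z'} → InV1 I v z' → InV1 I x z' → z' ≡ z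

  open Type1At

  Type1a⇒Type1At : Type1a I v x → Type1At x (a v)
  Type1a⇒Type1At (v#x , a∈x , b∉x) = record
    { conflict = v#x ; ∈v = inj₁ refl ; ∈x = a∈x
    ; unique   = λ { (inj₁ refl) _ → refl ; (inj₂ refl) b∈x → contradiction b∈x b∉x } }

  Type1b⇒Type1At : Type1b I v x → Type1At x (b v)
  Type1b⇒Type1At (v#x , b∈x , a∉x) = record
    { conflict = v#x ; ∈v = inj₂ refl ; ∈x = b∈x
    ; unique   = λ { (inj₁ refl) a∈x → contradiction a∈x a∉x ; (inj₂ refl) _ → refl } }

  Type1⇒Type1At : (x : C4 I) → Type1 I v x → ∃ (Type1At x)
  Type1⇒Type1At _ (inj₁ tx) = a v , Type1a⇒Type1At tx
  Type1⇒Type1At _ (inj₂ tx) = b v , Type1b⇒Type1At tx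

  Type1At⇒Clash : Type1At x z → Clash v x z
  Type1At⇒Clash {x = x} tx with Conflict⇒Clash v x (conflict tx)
  ... | _ , c@(clash g∈v g∈x _) with unique tx g∈v g∈x
  ... | refl = c

  -- At a vertex of V1(v), x and y both avoid v's edge, so they use the same (other) edge.
  Type1-clash-outside : Type1At x z → Type1At y z' → Clash x y g → ¬ InV1 I v g
  Type1-clash-outside tx ty x≠y@(clash g∈x g∈y _) g∈v with unique tx g∈v g∈x | unique ty g∈v g∈y
  ... | refl | refl = no-clash-triangle (Type1At⇒Clash tx) (Type1At⇒Clash ty) x≠y

  Type1-conflict⇒outside-clash : Type1At x z → Type1At y z' → Conflict I x y →
                                 ∃ λ g → Clash x y g × ¬ InV1 I v g
  Type1-conflict⇒outside-clash {x = x} {y = y} tx ty x#y with Conflict⇒Clash x y x#y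
  ... | g , x≠y = g , x≠y , Type1-clash-outside tx ty x≠y

  Type1-outside-unique : Type1At x z → InV1 I x g → InV1 I x g' → ¬ InV1 I v g → ¬ InV1 I v g' →
                         g ≡ g'
  Type1-outside-unique {x = x} tx g∈x g'∈x g∉v g'∉v =
    InV1-other-unique x (∈x tx) g∈x g'∈x (λ { refl → g∉v (∈v tx) }) (λ { refl → g'∉v (∈v tx) })

  Type1-conflicting-same : (w x y : C4 I) → Type1At w z → Type1At x z' → Type1At y z' →
                           Conflict I w x → Conflict I w y → Same I x y
  Type1-conflicting-same w x y tw tx ty w#x w#y
    with Type1-conflict⇒outside-clash tw tx w#x | Type1-conflict⇒outside-clash tw ty w#y
  ... | g , w≠x , g∉v | _ , w≠y , g'∉v
    with Type1-outside-unique tw (Clash.∈ˡ w≠x) (Clash.∈ˡ w≠y) g∉v g'∉v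
  ... | refl
    with Clash⇒common-edge w≠x w≠y | Clash⇒common-edge (Type1At⇒Clash tx) (Type1At⇒Clash ty)
  ... | _ , sxg , syg | _ , sxz , syz =
    shared-edges⇒Same x y sxz sxg syz syg λ { refl → g∉v (∈v tx) }

  covering-no-clash : InV1 I w (a v) → InV1 I w (b v) → DiffersAt v w z → Type1At x z →
                      ¬ Clash w x g
  covering-no-clash {w = w} a∈w b∈w v≠w tx w≠x@(clash g∈w g∈x _)
    with unique tx (InV1-covered w a∈w b∈w (a≢b v) g∈w) g∈x
  ... | refl = no-clash-triangle (clash (∈v tx) g∈w v≠w) (Type1At⇒Clash tx) w≠x

  Type2⇒DiffersAt : (x : C4 I) → Type2 I v x → DiffersAt v x z
  Type2⇒DiffersAt x (_ , _ , _ , c∉x , d∉x) sv sx refl with InSim⇒InV2 v sv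
  ... | inj₁ refl = c∉x (InSim⇒InV2 x sx)
  ... | inj₂ refl = d∉x (InSim⇒InV2 x sx)

  Type1-Type2-no-conflict : (w x : C4 I) → Type1 I v w → Type2 I v x → ¬ Conflict I w x
  Type1-Type2-no-conflict w x tw tx@(_ , a∈x , b∈x , _) w#x
    with Type1⇒Type1At w tw | Conflict⇒Clash w x w#x
  ... | _ , tw | _ , w≠x = covering-no-clash a∈x b∈x (Type2⇒DiffersAt x tx) tw (Clash-sym w≠x)

  Type3⇒meets-V2 : (w : C4 I) → Type3 I v w → InV2 I w (c v) ⊎ InV2 I w (d v)
  Type3⇒meets-V2 _ (_ , _ , _ , inj₁ (c∈w , _)) = inj₁ c∈w
  Type3⇒meets-V2 _ (_ , _ , _ , inj₂ (_ , d∈w)) = inj₂ d∈w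

  keeps-other-edge : (w : C4 I) → InSim I v (z , t) → InSim I v (z' , t') → InSim I w (z , f) →
                     t ≢ f → InV2 I w t ⊎ InV2 I w t' → InSim I w (z' , t')
  keeps-other-edge w sv _ sw t≢f (inj₁ t∈w) =
    contradiction (InSim-unique w (InV2⇒InSim-shared v w sv t∈w) sw) t≢f
  keeps-other-edge w _ sv' _ _ (inj₂ t'∈w) = InV2⇒InSim-shared v w sv' t'∈w

  Type3a⇒bc∈w : (w : C4 I) → Type3a I v w → InSim I w (b v , c v)
  Type3a⇒bc∈w w (t3 , _ , f≢d , s) =
    keeps-other-edge w (inj₁ refl) (inj₂ refl) s (f≢d ∘ sym) (swap (Type3⇒meets-V2 w t3))

  Type3b⇒ad∈w : (w : C4 I) → Type3b I v w → InSim I w (a v , d v)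
  Type3b⇒ad∈w w (t3 , _ , f≢c , s) =
    keeps-other-edge w (inj₂ refl) (inj₁ refl) s (f≢c ∘ sym) (Type3⇒meets-V2 w t3)

  Type3a⇒DiffersAt : (w : C4 I) → Type3a I v w → DiffersAt v w (a v)
  Type3a⇒DiffersAt w (_ , _ , f≢d , s) = ≢⇒DiffersAt v w (inj₁ refl) s (f≢d ∘ sym)

  Type3b⇒DiffersAt : (w : C4 I) → Type3b I v w → DiffersAt v w (b v)
  Type3b⇒DiffersAt w (_ , _ , f≢c , s) = ≢⇒DiffersAt v w (inj₂ refl) s (f≢c ∘ sym)

  shared-edge-conflict : (w x : C4 I) → InSim I v (z , t) → InSim I w (z , t) → Type1At x z →
                         InV1 I w z' → ¬ InV1 I x z' → Conflict I w x
  shared-edge-conflict w x sv sw tx z'∈w z'∉x =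
    Clash⇒Conflict w x (λ w≡x → z'∉x (Same⇒InV1 w x w≡x z'∈w)) (clash (InSim⇒InV1 w sw) (∈x tx)
      λ sw' sx → Clash.differs (Type1At⇒Clash tx) sv sx ∘ trans (InSim-unique w sw sw'))

  Type3a-Type1b-conflict : (w x : C4 I) → Type3a I v w → Type1b I v x → Conflict I w x
  Type3a-Type1b-conflict w x tw@((_ , a∈w , _) , _) tx@(_ , _ , a∉x) =
    shared-edge-conflict w x (inj₂ refl) (Type3a⇒bc∈w w tw) (Type1b⇒Type1At tx) a∈w a∉x

  Type3b-Type1a-conflict : (w x : C4 I) → Type3b I v w → Type1a I v x → Conflict I w x
  Type3b-Type1a-conflict w x tw@((_ , _ , b∈w , _) , _) tx@(_ , _ , b∉x) =
    shared-edge-conflict w x (inj₁ refl) (Type3b⇒ad∈w w tw) (Type1a⇒Type1At tx) b∈w b∉x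

  Type3-no-conflict : (w x : C4 I) → Type3 I v w → DiffersAt v w z → Type1At x z → ¬ Conflict I w x
  Type3-no-conflict w x (_ , a∈w , b∈w , _) v≠w tx w#x =
    covering-no-clash a∈w b∈w v≠w tx (proj₂ (Conflict⇒Clash w x w#x))

  no-Type1-triangle : (x y u : C4 I) → Type1 I v x → Type1 I v y → Type1 I v u →
                      ¬ (Conflict I x y × Conflict I y u × Conflict I x u)
  no-Type1-triangle x y u tx ty tu (x#y , y#u , x#u)
    with Type1⇒Type1At x tx | Type1⇒Type1At y ty | Type1⇒Type1At u tu
  ... | _ , tx | _ , ty | _ , tu
    with Type1-conflict⇒outside-clash tx ty x#y | Type1-conflict⇒outside-clash ty tu y#u
       | Type1-conflict⇒outside-clash tx tu x#u
  ... | _ , x≠y , g∉v | _ , y≠u , g'∉v | _ , x≠u , g''∉v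
    with Type1-outside-unique ty (Clash.∈ʳ x≠y) (Clash.∈ˡ y≠u) g∉v g'∉v
       | Type1-outside-unique tx (Clash.∈ˡ x≠y) (Clash.∈ˡ x≠u) g∉v g''∉v
  ... | refl | refl = no-clash-triangle x≠y x≠u y≠u

  no-Type1-induced-P4 : (x₀ x₁ x₂ x₃ : C4 I) →
                        Type1 I v x₀ → Type1 I v x₁ → Type1 I v x₂ → Type1 I v x₃ →
                        Conflict I x₀ x₁ → Conflict I x₁ x₂ → Conflict I x₂ x₃ →
                        ¬ Same I x₀ x₂ → ¬ Conflict I x₀ x₂ → ¬ Same I x₀ x₃ → ¬ Conflict I x₀ x₃ → ⊥
  no-Type1-induced-P4 x₀ x₁ x₂ x₃ t₀ t₁ t₂ t₃ x₀#x₁ x₁#x₂ x₂#x₃ x₀≉x₂ ¬x₀#x₂ x₀≉x₃ ¬x₀#x₃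
    with Type1⇒Type1At x₀ t₀ | Type1⇒Type1At x₁ t₁ | Type1⇒Type1At x₂ t₂ | Type1⇒Type1At x₃ t₃
  ... | _ , t₀ | _ , t₁ | _ , t₂ | _ , t₃
    with Type1-conflict⇒outside-clash t₀ t₁ x₀#x₁ | Type1-conflict⇒outside-clash t₁ t₂ x₁#x₂
       | Type1-conflict⇒outside-clash t₂ t₃ x₂#x₃
  ... | _ , x₀≠x₁ , g∉v | _ , x₁≠x₂ , g'∉v | _ , x₂≠x₃ , g''∉v
    with Type1-outside-unique t₁ (Clash.∈ʳ x₀≠x₁) (Clash.∈ˡ x₁≠x₂) g∉v g'∉v
       | Type1-outside-unique t₂ (Clash.∈ʳ x₁≠x₂) (Clash.∈ˡ x₂≠x₃) g'∉v g''∉v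
  ... | refl | refl
    with InV1⇒InSim x₀ (Clash.∈ˡ x₀≠x₁) | InV1⇒InSim x₂ (Clash.∈ˡ x₂≠x₃) | InV1⇒InSim x₃ (Clash.∈ʳ x₂≠x₃)
  ... | _ , s₀ | _ , s₂ | _ , s₃ =
    Clash.differs x₂≠x₃ s₂ s₃ (trans (sym (non-conflicting-agree x₀ x₂ x₀≉x₂ ¬x₀#x₂ s₀ s₂))
                                      (non-conflicting-agree x₀ x₃ x₀≉x₃ ¬x₀#x₃ s₀ s₃))

  no-Type1-induced-path : (k : ℕ) → k ≥ 4 → (f : Fin k → C4 I) →
                          ¬ (InducedPath I k f × (∀ i → Type1 I v (f i)))
  no-Type1-induced-path (suc (suc (suc (suc k)))) (s≤s (s≤s (s≤s (s≤s _)))) f ((distinct , adjacent⇔) , type1) =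
    no-Type1-induced-P4 (f i₀) (f i₁) (f i₂) (f i₃) (type1 i₀) (type1 i₁) (type1 i₂) (type1 i₃)
      (from (adjacent⇔ i₀ i₁) (inj₁ refl)) (from (adjacent⇔ i₁ i₂) (inj₁ refl))
      (from (adjacent⇔ i₂ i₃) (inj₁ refl))
      (distinct i₀ i₂ λ ()) (λ f₀#f₂ → case to (adjacent⇔ i₀ i₂) f₀#f₂ of λ { (inj₁ ()) ; (inj₂ ()) })
      (distinct i₀ i₃ λ ()) (λ f₀#f₃ → case to (adjacent⇔ i₀ i₃) f₀#f₃ of λ { (inj₁ ()) ; (inj₂ ()) })
    where
    open Equivalence
    i₀ i₁ i₂ i₃ : Fin (4 + k)
    i₀ = zero
    i₁ = suc zero
    i₂ = suc (suc zero)
    i₃ = suc (suc (suc zero))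

proposition5 : (I : Instance 2 1) (v : C4 I) →
    ((w : C4 I) → Type1a I v w → AtMostOne I (λ x → Type1a I v x × Conflict I w x))
  × ((w : C4 I) → Type1b I v w → AtMostOne I (λ x → Type1b I v x × Conflict I w x))
  × ((w : C4 I) → Type1a I v w → AtMostOne I (λ x → Type1b I v x × Conflict I w x))
  × ((w : C4 I) → Type1b I v w → AtMostOne I (λ x → Type1a I v x × Conflict I w x))
  × ((w x : C4 I) → Type1 I v w → Type2 I v x → ¬ Conflict I w x)
  × ((w x : C4 I) → Type3a I v w → Type1b I v x → Conflict I w x)
  × ((w x : C4 I) → Type3b I v w → Type1a I v x → Conflict I w x)
  × ((w x : C4 I) → Type3a I v w → Type1a I v x → ¬ Conflict I w x)
  × ((w x : C4 I) → Type3b I v w → Type1b I v x → ¬ Conflict I w x)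
  × ((x y z : C4 I) → Type1 I v x → Type1 I v y → Type1 I v z →
       ¬ (Conflict I x y × Conflict I y z × Conflict I x z))
  × ((k : ℕ) → k ≥ 4 → (f : Fin k → C4 I) →
       ¬ (InducedPath I k f × (∀ i → Type1 I v (f i))))
proposition5 I v =
    (λ w tw x y (tx , w#x) (ty , w#y) →
       Type1-conflicting-same w x y (Type1a⇒Type1At tw) (Type1a⇒Type1At tx) (Type1a⇒Type1At ty) w#x w#y)
  , (λ w tw x y (tx , w#x) (ty , w#y) →
       Type1-conflicting-same w x y (Type1b⇒Type1At tw) (Type1b⇒Type1At tx) (Type1b⇒Type1At ty) w#x w#y)
  , (λ w tw x y (tx , w#x) (ty , w#y) →
       Type1-conflicting-same w x y (Type1a⇒Type1At tw) (Type1b⇒Type1At tx) (Type1b⇒Type1At ty) w#x w#y)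
  , (λ w tw x y (tx , w#x) (ty , w#y) →
       Type1-conflicting-same w x y (Type1b⇒Type1At tw) (Type1a⇒Type1At tx) (Type1a⇒Type1At ty) w#x w#y)
  , Type1-Type2-no-conflict
  , Type3a-Type1b-conflict
  , Type3b-Type1a-conflict
  , (λ w x tw tx → Type3-no-conflict w x (proj₁ tw) (Type3a⇒DiffersAt w tw) (Type1a⇒Type1At tx))
  , (λ w x tw tx → Type3-no-conflict w x (proj₁ tw) (Type3b⇒DiffersAt w tw) (Type1b⇒Type1At tx))
  , no-Type1-triangle
  , no-Type1-induced-path
  where open Configurations I v
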